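{- Let $M$ be a countable structure and let $\mathcal{A}=\{M_i:i\in N\}$ be an $(M;\bar N;\Psi)$-system in $M$ (that is, an $(M,M';\bar N;\Psi)$-system with $M'=M$). If $\bar N$ is $\aleph_0$-categorical and each $M_i$ is $\aleph_0$-categorical over $\Psi_{i,i}$, then $M$ is $\aleph_0$-categorical.
   Context: Definition of $(M,M';\bar N;\Psi)$-system: $M$ is a structure with a fixed substructure $M'$; $\{M_i:i\in N\}$ is a set of substructures of $M'$ with $M'=\bigcup_{i\in N}M_i$, indexed by a structure $N$; $N_1,\dots,N_r$ is a finite partition of $N$ and $\bar N=(N;N_1,\dots,N_r)$ is the set extension of $N$ by unary relations $N_1,\dots,N_r$. For $i,j\in N$, $\Psi_{i,j}$ is a subset of the set of isomorphisms $M_i\to M_j$ such that: (1) if $i,j\in N_k$ for some $k$ then $\Psi_{i,j}\ne\emptyset$; (2) $\phi\in\Psi_{i,j}$, $\phi'\in\Psi_{j,\ell}$ imply $\phi\phi'\in\Psi_{i,\ell}$; (3) $\phi\in\Psi_{i,j}$ implies $\phi^{ -1}\in\Psi_{j,i}$; (4) if $\pi\in\mathrm{Aut}(\bar N)$ and $\phi_i\in\Psi_{i,i\pi}$ for all $i\in N$, then some automorphism of $M$ extends every $\phi_i$. (Then each $\Psi_{i,i}$ is a subgroup of $\mathrm{Aut}(M_i)$.) A structure $K$ is $\aleph_0$-categorical over a subgroup $\Phi\le\mathrm{Aut}(K)$ if $\Phi$ has finitely many orbits on $K^n$ for every $n\ge1$; a countable structure is $\aleph_0$-categorical iff its automorphism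 group has finitely many orbits on $K^n$ for each $n$. -}

module Defs where

open import Data.Nat using (ℕ)
open import Data.Fin using (Fin)
open import Data.Vec using (Vec; map; []; _∷_)
open import Data.Vec.Properties using (map-∘)
open import Data.Product using (Σ; Σ-syntax; ∃; ∃-syntax; _×_; _,_; proj₁; proj₂)
open import Data.Sum using (_⊎_; inj₁; inj₂)
open import Data.Unit using (⊤)
open import Function using (_∘_; Injective)
open import Relation.Binary.PropositionalEquality
  using (_≡_; refl; sym; trans; cong; subst)

record Signature : Set₁ where
  field
    Rel  : Set
    rar  : Rel → ℕ
    Fun  : Set
    far  : Fun → ℕ
open Signature public

record Structure (σ : Signature) : Set₁ where
  field
    Carrier : Set
    rel     : (R : Rel σ) → Vec Carrier (rar σ R) → Set
    fun     : (f : Fun σ) → Vec Carrier (far σ f) → Carrier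
open Structure public

Countable : ∀ {σ} → Structure σ → Set
Countable K = Σ[ e ∈ (Carrier K → ℕ) ] Injective _≡_ _≡_ e

record Iso {σ : Signature} (A B : Structure σ) : Set where
  field
    to       : Carrier A → Carrier B
    from     : Carrier B → Carrier A
    from-to  : ∀ x → from (to x) ≡ x
    to-from  : ∀ y → to (from y) ≡ y
    rel-to   : ∀ R xs → rel A R xs → rel B R (map to xs)
    rel-from : ∀ R xs → rel B R (map to xs) → rel A R xs
    fun-pres : ∀ f xs → to (fun A f xs) ≡ fun B f (map to xs)
open Iso public

Aut : ∀ {σ} → Structure σ → Set
Aut K = Iso K K

iso⁻¹ : ∀ {σ} {A B : Structure σ} → Iso A B → Iso B A
iso⁻¹ {σ} {A} {B} φ = record
  { to = from φ ; from = to φ ; from-to = to-from φ ; to-from = from-to φ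
  ; rel-to = λ R ys r → rel-from φ R (map (from φ) ys) (subst (rel B R) (sym (mt ys)) r)
  ; rel-from = λ R ys r → subst (rel B R) (mt ys) (rel-to φ R (map (from φ) ys) r)
  ; fun-pres = λ f ys → trans (cong (λ z → from φ (fun B f z)) (sym (mt ys)))
                  (trans (cong (from φ) (sym (fun-pres φ f (map (from φ) ys))))
                         (from-to φ _)) }
  where
  mt : ∀ {n} (ys : Vec (Carrier B) n) → map (to φ) (map (from φ) ys) ≡ ys
  mt [] = refl
  mt (y ∷ ys) = cong₂' (to-from φ y) (mt ys)
    where
    cong₂' : ∀ {n} {a b : Carrier B} {as bs : Vec (Carrier B) n} → a ≡ b → as ≡ bs → (a ∷ as) ≡ (b ∷ bs)
    cong₂' refl refl = refl

-- Composition, written diagrammatically as in the paper: φ then φ'.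
_⨾_ : ∀ {σ} {A B C : Structure σ} → Iso A B → Iso B C → Iso A C
_⨾_ {σ} {A} {B} {C} φ φ' = record
  { to = to φ' ∘ to φ
  ; from = from φ ∘ from φ'
  ; from-to = λ x → trans (cong (from φ) (from-to φ' (to φ x))) (from-to φ x)
  ; to-from = λ y → trans (cong (to φ') (to-from φ (from φ' y))) (to-from φ' y)
  ; rel-to = λ R xs r → subst (rel C R) (sym (map-∘ (to φ') (to φ) xs))
                          (rel-to φ' R (map (to φ) xs) (rel-to φ R xs r))
  ; rel-from = λ R xs r → rel-from φ R xs (rel-from φ' R (map (to φ) xs)
                          (subst (rel C R) (map-∘ (to φ') (to φ) xs) r))
  ; fun-pres = λ f xs → trans (cong (to φ') (fun-pres φ f xs))
                 (trans (fun-pres φ' f (map (to φ) xs))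
                        (cong (fun C f) (sym (map-∘ (to φ') (to φ) xs)))) }

record Substructure {σ} (M : Structure σ) : Set₁ where
  field
    mem      : Carrier M → Set
    mem-prop : ∀ x (p q : mem x) → p ≡ q
    closed   : ∀ f (xs : Vec (Σ (Carrier M) mem) (far σ f)) → mem (fun M f (map proj₁ xs))
open Substructure public

induced : ∀ {σ} {M : Structure σ} → Substructure M → Structure σ
induced {σ} {M} S = record
  { Carrier = Σ (Carrier M) (mem S)
  ; rel = λ R xs → rel M R (map proj₁ xs)
  ; fun = λ f xs → fun M f (map proj₁ xs) , closed S f xs }

Aleph0CatOver : ∀ {σ} (K : Structure σ) → (Aut K → Set) → Set
Aleph0CatOver K Φ =
  ∀ (n : ℕ) → 1 Data.Nat.≤ n →
  Σ[ k ∈ ℕ ] Σ[ ts ∈ (Fin k → Vec (Carrier K) n) ]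
    ∀ (xs : Vec (Carrier K) n) →
      Σ[ j ∈ Fin k ] Σ[ g ∈ Aut K ] (Φ g × map (to g) (ts j) ≡ xs)

Aleph0Cat : ∀ {σ} (K : Structure σ) → Set
Aleph0Cat K = Aleph0CatOver K (λ _ → ⊤)

-- Set extension N̄ = (N; N₁,…,N_r) of N by unary predicates for a
-- partition of N into r parts, given by  part : N → Fin r.

extSig : Signature → ℕ → Signature
extSig τ r = record
  { Rel = Rel τ ⊎ Fin r
  ; rar = λ { (inj₁ R) → rar τ R ; (inj₂ _) → 1 }
  ; Fun = Fun τ
  ; far = far τ }

setExt : ∀ {τ} (N : Structure τ) (r : ℕ) → (Carrier N → Fin r) → Structure (extSig τ r)
setExt {τ} N r part = record
  { Carrier = Carrier N
  ; rel = λ { (inj₁ R) xs → rel N R xs ; (inj₂ k) (x ∷ []) → part x ≡ k }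
  ; fun = fun N }

record System {σ τ : Signature} (M : Structure σ) (N : Structure τ) (r : ℕ) : Set₁ where
  field
    part  : Carrier N → Fin r
    Msub  : Carrier N → Substructure M
    -- M' = M = ⋃_{i ∈ N} M_i
    cover : ∀ (x : Carrier M) → Σ[ i ∈ Carrier N ] mem (Msub i) x
    Ψ     : ∀ i j → Iso (induced (Msub i)) (induced (Msub j)) → Set
    Ψ-nonempty : ∀ i j → part i ≡ part j →
                 Σ[ φ ∈ Iso (induced (Msub i)) (induced (Msub j)) ] Ψ i j φ
    Ψ-comp : ∀ i j l (φ : Iso (induced (Msub i)) (induced (Msub j)))
               (φ' : Iso (induced (Msub j)) (induced (Msub l))) →
             Ψ i j φ → Ψ j l φ' → Ψ i l (φ ⨾ φ')
    Ψ-inv  : ∀ i j (φ : Iso (induced (Msub i)) (induced (Msub j))) →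
             Ψ i j φ → Ψ j i (iso⁻¹ φ)
    Ψ-ext  : ∀ (π : Aut (setExt N r part))
               (φ : ∀ i → Iso (induced (Msub i)) (induced (Msub (to π i)))) →
             (∀ i → Ψ i (to π i) (φ i)) →
             Σ[ α ∈ Aut M ] ∀ i (x : Carrier (induced (Msub i))) →
               to α (proj₁ x) ≡ proj₁ (to (φ i) x)
open System public

module Submission where

-- Fix n ≥ 1 and a tuple x̄ ∈ Mⁿ.  Each x_m lies in some
-- component M_{i_m}.  By ℵ₀-categoricity of N̄ the index tuple ī is the image π(Ī) of
-- one of finitely many representatives Ī; the automorphism π lifts, via conditions
-- (1) and (4) of a system, to an automorphism α of M, so x̄ = α(ȳ) with y_m ∈ M_{I_m}.
-- Next, for every position k the entries of ȳ lying in M_{I_k} form (after padding) a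
-- tuple of M_{I_k}, which is a Ψ_{I_k,I_k}-image of one of finitely many representatives;
-- condition (4) with π = id glues these local automorphisms into one automorphism h of M.
-- Hence x̄ is an automorphic image of a tuple determined by finitely many choices: the
-- representative Ī and one local representative per position.

open import Defs
open import Data.Nat using (ℕ; zero; suc; _+_; _*_; s≤s; z≤n)
open import Data.Fin using (Fin; zero; suc; splitAt; _↑ˡ_; _↑ʳ_; remQuot; combine)
open import Data.Fin.Properties using (splitAt-↑ˡ; splitAt-↑ʳ; remQuot-combine)
  renaming (_≟_ to _≟ᶠ_)
open import Data.Vec using (Vec; []; _∷_; lookup; tabulate; map)
open import Data.Vec.Properties
  using (lookup-map; lookup∘tabulate; tabulate∘lookup; tabulate-∘; tabulate-cong; ∷-injective; map-id)
open import Data.Vec.Relation.Unary.Any using (index)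
open import Data.Vec.Relation.Unary.Any.Properties using (lookup-index)
open import Data.Vec.Membership.Propositional.Properties using (∈-lookup)
open import Data.Product using (Σ; Σ-syntax; _×_; _,_; proj₁; proj₂)
open import Data.Sum using (inj₂; [_,_]′)
open import Data.Unit using (⊤; tt)
open import Data.Empty using (⊥-elim)
open import Function using (_∘_)
open import Relation.Nullary using (Dec; yes; no)
open import Relation.Nullary.Decidable using (map′)
open import Relation.Binary.Definitions using (DecidableEquality)
open import Relation.Binary.PropositionalEquality
  using (_≡_; refl; sym; trans; cong; subst; module ≡-Reasoning)

choiceFunctions : ∀ n (s : Fin n → ℕ) →
  Σ[ T ∈ ℕ ] Σ[ F ∈ (Fin T → (k : Fin n) → Fin (s k)) ]
    ∀ (c : (k : Fin n) → Fin (s k)) → Σ[ t ∈ Fin T ] (∀ k → F t k ≡ c k)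
choiceFunctions zero s = 1 , (λ _ ()) , λ c → zero , λ ()
choiceFunctions (suc n) s with choiceFunctions n (s ∘ suc)
... | T , F , F-lists = s zero * T , G , G-lists
  where
  G : Fin (s zero * T) → (k : Fin (suc n)) → Fin (s k)
  G t zero    = proj₁ (remQuot {s zero} T t)
  G t (suc k) = F (proj₂ (remQuot {s zero} T t)) k

  G-lists : ∀ (c : (k : Fin (suc n)) → Fin (s k)) → Σ[ t ∈ Fin (s zero * T) ] (∀ k → G t k ≡ c k)
  G-lists c = combine (c zero) t , pointwise
    where
    t : Fin T
    t = proj₁ (F-lists (c ∘ suc))

    pointwise : ∀ k → G (combine (c zero) t) k ≡ c k
    pointwise zero    = cong proj₁ (remQuot-combine (c zero) t)
    pointwise (suc k) = trans (cong (λ q → F (proj₂ q) k) (remQuot-combine (c zero) t))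
                              (proj₂ (F-lists (c ∘ suc)) k)

⋃-families : ∀ {A : Set} K (s : Fin K → ℕ) (F : (l : Fin K) → Fin (s l) → A) →
  Σ[ T ∈ ℕ ] Σ[ G ∈ (Fin T → A) ] ∀ l j → Σ[ t ∈ Fin T ] G t ≡ F l j
⋃-families zero s F = 0 , (λ ()) , λ ()
⋃-families {A} (suc K) s F with ⋃-families K (s ∘ suc) (F ∘ suc)
... | T , G , G-lists = s zero + T , H , H-lists
  where
  H : Fin (s zero + T) → A
  H = [ F zero , G ]′ ∘ splitAt (s zero)

  H-lists : ∀ l j → Σ[ t ∈ Fin (s zero + T) ] H t ≡ F l j
  H-lists zero j    = j ↑ˡ T , cong [ F zero , G ]′ (splitAt-↑ˡ (s zero) j T)
  H-lists (suc l) j = s zero ↑ʳ proj₁ (G-lists l j)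
    , trans (cong [ F zero , G ]′ (splitAt-↑ʳ (s zero) T (proj₁ (G-lists l j))))
            (proj₂ (G-lists l j))

map-tabulate-onto : ∀ {A B : Set} {n} (f : A → B) (g : Fin n → A) (xs : Vec B n) →
  (∀ m → f (g m) ≡ lookup xs m) → map f (tabulate g) ≡ xs
map-tabulate-onto f g xs pointwise =
  trans (sym (tabulate-∘ f g)) (trans (tabulate-cong pointwise) (tabulate∘lookup xs))

idAut : ∀ {σ} (K : Structure σ) → Aut K
idAut K = record
  { to = λ x → x ; from = λ x → x ; from-to = λ _ → refl ; to-from = λ _ → refl
  ; rel-to   = λ R xs r → subst (rel K R) (sym (map-id xs)) r
  ; rel-from = λ R xs r → subst (rel K R) (map-id xs) r
  ; fun-pres = λ f xs → cong (fun K f) (sym (map-id xs)) }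

aut-injective : ∀ {σ} {K : Structure σ} (g : Aut K) {x y : Carrier K} →
  to g x ≡ to g y → x ≡ y
aut-injective g {x} {y} gx≡gy =
  trans (sym (from-to g x)) (trans (cong (from g) gx≡gy) (from-to g y))

-- If one automorphism maps a pair t to (a , b) and another maps t to the diagonal pair
-- (a , a), then t is itself diagonal, hence a ≡ b.
diagonal-pair : ∀ {σ} {K : Structure σ} (g g' : Aut K) (t : Vec (Carrier K) 2)
  {a b : Carrier K} → map (to g) t ≡ a ∷ b ∷ [] → map (to g') t ≡ a ∷ a ∷ [] → a ≡ b
diagonal-pair g g' (u ∷ v ∷ []) refl g't≡aa =
  cong (to g) (aut-injective g' (trans g'u≡gu (sym g'v≡gu)))
  where
  g'u≡gu : to g' u ≡ to g u
  g'u≡gu = proj₁ (∷-injective g't≡aa)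

  g'v≡gu : to g' v ≡ to g u
  g'v≡gu = proj₁ (∷-injective (proj₂ (∷-injective g't≡aa)))

FinitelyManyOrbits : ∀ {σ} (K : Structure σ) → (Aut K → Set) → ℕ → Set
FinitelyManyOrbits K Φ n =
  Σ[ k ∈ ℕ ] Σ[ ts ∈ (Fin k → Vec (Carrier K) n) ]
    ∀ (xs : Vec (Carrier K) n) →
      Σ[ j ∈ Fin k ] Σ[ g ∈ Aut K ] (Φ g × map (to g) (ts j) ≡ xs)

-- Finitely many orbits on pairs make equality decidable: a ≡ b exactly when (a , b)
-- lies in the orbit of (a , a), and orbits are numbered by Fin k.
orbits⇒decEq : ∀ {σ} {K : Structure σ} {Φ : Aut K → Set} →
  FinitelyManyOrbits K Φ 2 → DecidableEquality (Carrier K)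
orbits⇒decEq {K = K} (k , ts , orbit) a b =
  map′ sameOrbit⇒≡ (λ a≡b → cong (orbitOf a) (sym a≡b)) (orbitOf a b ≟ᶠ orbitOf a a)
  where
  orbitOf : Carrier K → Carrier K → Fin k
  orbitOf x y = proj₁ (orbit (x ∷ y ∷ []))

  sameOrbit⇒≡ : orbitOf a b ≡ orbitOf a a → a ≡ b
  sameOrbit⇒≡ same =
    let (_ , g  , _ , g-maps)  = orbit (a ∷ b ∷ [])
        (_ , g' , _ , g'-maps) = orbit (a ∷ a ∷ [])
    in diagonal-pair g g' (ts (orbitOf a a))
         (subst (λ j → map (to g) (ts j) ≡ a ∷ b ∷ []) same g-maps) g'-maps

module _ {σ τ : Signature} {M : Structure σ} {N : Structure τ} {r : ℕ}
         (𝒜 : System M N r) where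

  N̄ : Structure (extSig τ r)
  N̄ = setExt N r (part 𝒜)

  Mi : Carrier N → Structure σ
  Mi i = induced (Msub 𝒜 i)

  Elt : Carrier N → Set
  Elt i = Carrier (Mi i)

  PsiAut : Carrier N → Set
  PsiAut i = Σ (Aut (Mi i)) (Ψ 𝒜 i i)

  component : Carrier M → Carrier N
  component x = proj₁ (cover 𝒜 x)

  proj₁-subst : ∀ {i j} (e : i ≡ j) (x : Elt i) → proj₁ (subst Elt e x) ≡ proj₁ x
  proj₁-subst refl x = refl

  to-subst : ∀ {i j} (e : i ≡ j) (ψ : PsiAut i) (x : Elt i) →
    to (proj₁ (subst PsiAut e ψ)) (subst Elt e x) ≡ subst Elt e (to (proj₁ ψ) x)
  to-subst refl ψ x = refl

  -- Every automorphism π of N̄ lifts to an automorphism α of M mapping M_i onto M_{π i}: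
  -- π preserves the parts, so (1) yields φ_i ∈ Ψ_{i,π i}, and (4) extends all of them.
  liftAut : (π : Aut N̄) →
    Σ[ α ∈ Aut M ] ∀ i (y : Elt (to π i)) → Σ[ x ∈ Elt i ] to α (proj₁ x) ≡ proj₁ y
  liftAut π = α , λ i y →
    from (φ i) y , trans (α-extends i (from (φ i) y)) (cong proj₁ (to-from (φ i) y))
    where
    φΨ : ∀ i → Σ (Iso (Mi i) (Mi (to π i))) (Ψ 𝒜 i (to π i))
    φΨ i = Ψ-nonempty 𝒜 i (to π i) (sym (rel-to π (inj₂ (part 𝒜 i)) (i ∷ []) refl))

    φ : ∀ i → Iso (Mi i) (Mi (to π i))
    φ i = proj₁ (φΨ i)

    extension : Σ[ α ∈ Aut M ] ∀ i (x : Elt i) → to α (proj₁ x) ≡ proj₁ (to (φ i) x)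
    extension = Ψ-ext 𝒜 π φ (proj₂ ∘ φΨ)

    α : Aut M
    α = proj₁ extension

    α-extends : ∀ i (x : Elt i) → to α (proj₁ x) ≡ proj₁ (to (φ i) x)
    α-extends = proj₂ extension

  pullBack : ∀ {n} (I : Vec (Carrier N) n) (π : Aut N̄) (xs : Vec (Carrier M) n) →
    map (to π) I ≡ map component xs →
    Σ[ α ∈ Aut M ] Σ[ Y ∈ (∀ m → Elt (lookup I m)) ] ∀ m → to α (proj₁ (Y m)) ≡ lookup xs m
  pullBack I π xs πI≡ = α , (λ m → proj₁ (lifted m)) , (λ m → proj₂ (lifted m))
    where
    α : Aut M
    α = proj₁ (liftAut π)

    πI≡component : ∀ m → to π (lookup I m) ≡ component (lookup xs m)
    πI≡component m = begin
      to π (lookup I m)           ≡⟨ lookup-map m (to π) I ⟨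
      lookup (map (to π) I) m     ≡⟨ cong (λ v → lookup v m) πI≡ ⟩
      lookup (map component xs) m ≡⟨ lookup-map m component xs ⟩
      component (lookup xs m)     ∎
      where open ≡-Reasoning

    xs∈M : ∀ m → Elt (to π (lookup I m))
    xs∈M m = lookup xs m
           , subst (λ i → mem (Msub 𝒜 i) (lookup xs m)) (sym (πI≡component m))
                   (proj₂ (cover 𝒜 (lookup xs m)))

    lifted : ∀ m → Σ[ x ∈ Elt (lookup I m) ] to α (proj₁ x) ≡ lookup xs m
    lifted m = proj₂ (liftAut π) (lookup I m) (xs∈M m)

  module Gluing (_≟_ : DecidableEquality (Carrier N)) {n : ℕ}
                (orbitsMi : ∀ i → FinitelyManyOrbits (Mi i) (Ψ 𝒜 i i) n) where

    open import Data.Vec.Membership.DecPropositional _≟_ using (_∈_; _∈?_)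

    reps : ∀ i → Fin (proj₁ (orbitsMi i)) → Vec (Elt i) n
    reps i = proj₁ (proj₂ (orbitsMi i))

    -- A code for the index tuple I chooses one local representative per position.
    Code : Vec (Carrier N) n → Set
    Code I = (k : Fin n) → Fin (proj₁ (orbitsMi (lookup I k)))

    -- Position m of the glued tuple: find a position k with I_k = I_m and take the
    -- m-th entry of the representative chosen at k (it lies in M_{I_k} = M_{I_m}).
    glueElt : (I : Vec (Carrier N) n) → Code I → ∀ m → Dec (lookup I m ∈ I) → Elt (lookup I m)
    glueElt I c m (yes p) =
      subst Elt (sym (lookup-index p)) (lookup (reps (lookup I (index p)) (c (index p))) m)
    glueElt I c m (no ∉) = ⊥-elim (∉ (∈-lookup m I))

    glued : (I : Vec (Carrier N) n) → Code I → Fin n → Carrier M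
    glued I c m = proj₁ (glueElt I c m (lookup I m ∈? I))

    glued-cong : ∀ I {c c' : Code I} → (∀ k → c k ≡ c' k) → ∀ m → glued I c m ≡ glued I c' m
    glued-cong I {c} {c'} c≗c' m = cong proj₁ (glueElt-cong (lookup I m ∈? I))
      where
      glueElt-cong : ∀ d → glueElt I c m d ≡ glueElt I c' m d
      glueElt-cong (yes p) = cong (λ j → subst Elt (sym (lookup-index p))
                                           (lookup (reps (lookup I (index p)) j) m))
                                  (c≗c' (index p))
      glueElt-cong (no ∉)  = ⊥-elim (∉ (∈-lookup m I))

    -- At each
    -- position k the entries of Y lying in M_{I_k}, padded by Y_k, form a tuple local k
    -- of M_{I_k}, which is ψ_k(representative c_k) with ψ_k ∈ Ψ_{I_k,I_k}; condition (4)
    -- with π = id merges the ψ_k into one automorphism h of M.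
    module Glue (I : Vec (Carrier N) n) (Y : ∀ m → Elt (lookup I m)) where
      restrict : ∀ k m → Dec (lookup I m ≡ lookup I k) → Elt (lookup I k)
      restrict k m (yes e) = subst Elt e (Y m)
      restrict k m (no _)  = Y k

      restrict-same : ∀ k m d → lookup I m ≡ lookup I k → proj₁ (restrict k m d) ≡ proj₁ (Y m)
      restrict-same k m (yes e) _ = proj₁-subst e (Y m)
      restrict-same k m (no ≢)  e = ⊥-elim (≢ e)

      local : ∀ k → Vec (Elt (lookup I k)) n
      local k = tabulate (λ m → restrict k m (lookup I m ≟ lookup I k))

      localOrbit : ∀ k → Σ[ j ∈ Fin (proj₁ (orbitsMi (lookup I k))) ] Σ[ g ∈ Aut (Mi (lookup I k)) ]
                           (Ψ 𝒜 (lookup I k) (lookup I k) g × map (to g) (reps (lookup I k) j) ≡ local k)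
      localOrbit k = proj₂ (proj₂ (orbitsMi (lookup I k))) (local k)

      c : Code I
      c k = proj₁ (localOrbit k)

      ψ : ∀ k → PsiAut (lookup I k)
      ψ k = let (_ , g , g∈Ψ , _) = localOrbit k in g , g∈Ψ

      ψ-maps : ∀ k → map (to (proj₁ (ψ k))) (reps (lookup I k) (c k)) ≡ local k
      ψ-maps k = proj₂ (proj₂ (proj₂ (localOrbit k)))

      family : ∀ i → Dec (i ∈ I) → PsiAut i
      family i (yes p) = subst PsiAut (sym (lookup-index p)) (ψ (index p))
      family i (no _)  = Ψ-nonempty 𝒜 i i refl

      extension : Σ[ h ∈ Aut M ] ∀ i (x : Elt i) →
        to h (proj₁ x) ≡ proj₁ (to (proj₁ (family i (i ∈? I))) x)
      extension = Ψ-ext 𝒜 (idAut N̄) (λ i → proj₁ (family i (i ∈? I)))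
                                    (λ i → proj₂ (family i (i ∈? I)))

      h : Aut M
      h = proj₁ extension

      h-extends : ∀ i (x : Elt i) → to h (proj₁ x) ≡ proj₁ (to (proj₁ (family i (i ∈? I))) x)
      h-extends = proj₂ extension

      family-glued : ∀ m d →
        proj₁ (to (proj₁ (family (lookup I m) d)) (glueElt I c m d)) ≡ proj₁ (Y m)
      family-glued m (no ∉)  = ⊥-elim (∉ (∈-lookup m I))
      family-glued m (yes p) = begin
        proj₁ (to (proj₁ (subst PsiAut e (ψ k))) (subst Elt e (lookup t m)))
          ≡⟨ cong proj₁ (to-subst e (ψ k) (lookup t m)) ⟩
        proj₁ (subst Elt e (to g (lookup t m)))   ≡⟨ proj₁-subst e (to g (lookup t m)) ⟩
        proj₁ (to g (lookup t m))                 ≡⟨ cong proj₁ (lookup-map m (to g) t) ⟨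
        proj₁ (lookup (map (to g) t) m)           ≡⟨ cong (λ v → proj₁ (lookup v m)) (ψ-maps k) ⟩
        proj₁ (lookup (local k) m)                ≡⟨ cong proj₁ (lookup∘tabulate _ m) ⟩
        proj₁ (restrict k m (lookup I m ≟ lookup I k))
          ≡⟨ restrict-same k m (lookup I m ≟ lookup I k) (lookup-index p) ⟩
        proj₁ (Y m)                               ∎
        where
        open ≡-Reasoning
        k : Fin n
        k = index p
        e : lookup I k ≡ lookup I m
        e = sym (lookup-index p)
        g : Aut (Mi (lookup I k))
        g = proj₁ (ψ k)
        t : Vec (Elt (lookup I k)) n
        t = reps (lookup I k) (c k)

      h-glued : ∀ m → to h (glued I c m) ≡ proj₁ (Y m)
      h-glued m = trans (h-extends (lookup I m) (glueElt I c m (lookup I m ∈? I)))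
                        (family-glued m (lookup I m ∈? I))

    glue : (I : Vec (Carrier N) n) (Y : ∀ m → Elt (lookup I m)) →
      Σ[ c ∈ Code I ] Σ[ h ∈ Aut M ] ∀ m → to h (glued I c m) ≡ proj₁ (Y m)
    glue I Y = c , h , h-glued
      where open Glue I Y

  -- The representatives are the glued tuples for all representatives
  -- I_l of N̄ and all codes, which are finitely many by choiceFunctions and ⋃-families.
  orbitsOfSystem : ∀ {n} → DecidableEquality (Carrier N) →
    FinitelyManyOrbits N̄ (λ _ → ⊤) n →
    (∀ i → FinitelyManyOrbits (Mi i) (Ψ 𝒜 i i) n) →
    FinitelyManyOrbits M (λ _ → ⊤) n
  orbitsOfSystem {n} _≟_ (kN , I , orbitN) orbitsMi = T , ts , reaches
    where
    open Gluing _≟_ orbitsMi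

    codes : ∀ l → Σ[ K ∈ ℕ ] Σ[ F ∈ (Fin K → Code (I l)) ]
                    ∀ (c : Code (I l)) → Σ[ t ∈ Fin K ] (∀ k → F t k ≡ c k)
    codes l = choiceFunctions n (λ k → proj₁ (orbitsMi (lookup (I l) k)))

    allGlued : Σ[ T ∈ ℕ ] Σ[ ts ∈ (Fin T → Vec (Carrier M) n) ] ∀ l t →
      Σ[ j ∈ Fin T ] ts j ≡ tabulate (glued (I l) (proj₁ (proj₂ (codes l)) t))
    allGlued = ⋃-families kN (λ l → proj₁ (codes l))
                 (λ l t → tabulate (glued (I l) (proj₁ (proj₂ (codes l)) t)))

    T : ℕ
    T = proj₁ allGlued

    ts : Fin T → Vec (Carrier M) n
    ts = proj₁ (proj₂ allGlued)

    reaches : ∀ xs → Σ[ j ∈ Fin T ] Σ[ g ∈ Aut M ] (⊤ × map (to g) (ts j) ≡ xs)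
    reaches xs =
      let (l , π , _ , πI≡) = orbitN (map component xs)
          (α , Y , α-maps)  = pullBack (I l) π xs πI≡
          (c , h , h-maps)  = glue (I l) Y
          (t , listed)      = proj₂ (proj₂ (codes l)) c
          (j , ts-j)        = proj₂ (proj₂ allGlued) l t
          hα-maps : ∀ m → to α (to h (glued (I l) (proj₁ (proj₂ (codes l)) t) m)) ≡ lookup xs m
          hα-maps m = trans (cong (to α ∘ to h) (glued-cong (I l) listed m))
                            (trans (cong (to α) (h-maps m)) (α-maps m))
      in j , h ⨾ α , tt
           , trans (cong (map (to (h ⨾ α))) ts-j) (map-tabulate-onto _ _ xs hα-maps)

-- Corollary 3.5: ℵ₀-categoricity of N̄ gives decidable equality on N (orbits on pairs)
-- and finitely many orbits on Nⁿ; combined with the local hypotheses, orbitsOfSystem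
-- yields finitely many orbits of Aut M on Mⁿ for every n ≥ 1.
corollary3p5 : ∀ {σ τ : Signature} (M : Structure σ) (N : Structure τ) (r : ℕ)
    (𝒜 : System M N r) →
    Countable M →
    Aleph0Cat (setExt N r (part 𝒜)) →
    (∀ i → Aleph0CatOver (induced (Msub 𝒜 i)) (Ψ 𝒜 i i)) →
    Aleph0Cat M
corollary3p5 M N r 𝒜 _ catN̄ catMi n 1≤n =
  orbitsOfSystem 𝒜 (orbits⇒decEq (catN̄ 2 (s≤s z≤n))) (catN̄ n 1≤n) (λ i → catMi i n 1≤n)
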